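{- Let $m,n$ be positive integers, $K$ a field, $G$ the $m\times n$ rectangular graph, and let $v:G\to K$ satisfy, for every $(i,j)\in G$, $$v_{i,j-1}+v_{i,j+1}+v_{i-1,j}+v_{i+1,j}=0,$$ where $v_{p,q}:=0$ whenever $(p,q)\notin G$ (i.e. $v$ lies in the kernel of the adjacency matrix of $G$). Then: (i) whenever $(i,j)$ and $(j,i)$ both belong to $G$, we have $v_{i,j}=v_{j,i}$ if $i+j$ is even and $v_{i,j}=-v_{j,i}$ if $i+j$ is odd; (ii) if $v_{m_0,j}=0$ for all $j$ with $(m_0,j)\in G$ (i.e. $v$ vanishes on the column $x=m_0$), then $v_{m_0-i,j}=-v_{m_0+i,j}$ whenever both points belong to $G$.
   Context: The $m\times n$ rectangular graph is $G=\{(x,y)\in\mathbb{Z}^2: 0\le x\le m-1,\ 0\le y\le n-1\}$, where two points are adjacent iff they differ by exactly $1$ in exactly one coordinate. -}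

module Defs where

open import Level using (Level; _⊔_) renaming (suc to lsuc)
open import Algebra.Bundles using (CommutativeRing)
open import Data.Nat as ℕ using (ℕ; _<?_)
open import Data.Fin using (Fin; fromℕ<)
open import Data.Integer as ℤ using (ℤ; +_; -[1+_])
open import Data.Product using (∃; _×_)
open import Relation.Nullary using (¬_; yes; no)

record Field (c ℓ : Level) : Set (lsuc (c ⊔ ℓ)) where
  field
    commutativeRing : CommutativeRing c ℓ
  open CommutativeRing commutativeRing public
  field
    1≉0     : ¬ (1# ≈ 0#)
    inverse : ∀ x → ¬ (x ≈ 0#) → ∃ λ y → x * y ≈ 1#

InG : ℕ → ℕ → ℤ → ℤ → Set
InG m n p q = (+ 0 ℤ.≤ p × p ℤ.< + m) × (+ 0 ℤ.≤ q × q ℤ.< + n)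

module _ {c ℓ : Level} (K : Field c ℓ) where
  open Field K

  ext : {m n : ℕ} → (Fin m → Fin n → Carrier) → ℤ → ℤ → Carrier
  ext {m} {n} v (+ a) (+ b) with a <? m | b <? n
  ... | yes a<m | yes b<n = v (fromℕ< a<m) (fromℕ< b<n)
  ... | _       | _       = 0#
  ext v (+ a)    -[1+ b ] = 0#
  ext v -[1+ a ] q        = 0#

  InKernel : (m n : ℕ) → (Fin m → Fin n → Carrier) → Set ℓ
  InKernel m n v = ∀ (i j : ℤ) → InG m n i j →
    ext v i (j ℤ.- + 1) + ext v i (j ℤ.+ + 1)
      + ext v (i ℤ.- + 1) j + ext v (i ℤ.+ + 1) j ≈ 0#

{-# OPTIONS --safe #-}
module Submission where

-- Put u(x, y) = (-1)^x v(x, y). The kernel equation says that at every point of G the two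
-- vertical neighbours of u have the same sum as the two horizontal ones. This condition is
-- invariant under transposition, and it determines u(x, y + 1) from values nearer the border,
-- where u vanishes; hence, by induction on max(x, y), u(x, y) = u(y, x) on the square part
-- of G, which is (i).
-- For (ii), add the kernel equations at two columns m₀ - i and m₀ + i known to be opposite:
-- their vertical terms cancel, and what is left shows that the columns at distance i + 1 from
-- m₀ are opposite once those at distance i - 1 are. The induction starts from the vanishing
-- column m₀ itself and, for i = 1, from the kernel equation on it.

open import Defs
open import Level using (Level)
open import Data.Nat as ℕ using (ℕ)
open import Data.Fin using (Fin)
open import Data.Integer as ℤ using (ℤ; +_)
open import Data.Integer.Divisibility using (_∣_)
open import Data.Product using (_×_; _,_; proj₁; proj₂; ∃-syntax)
open import Relation.Nullary using (¬_; yes; no)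

open import Algebra.Bundles using (AbelianGroup)
import Algebra.Properties.AbelianGroup as AbelianGroupProperties
import Algebra.Properties.Group as GroupProperties
import Algebra.Solver.CommutativeMonoid as CommutativeMonoidSolver
open import Data.Empty using (⊥-elim)
open import Data.Integer.Tactic.RingSolver using (solve-∀)
import Data.Integer.Properties as ℤₚ
open import Data.Nat using (zero; suc; _≤_; _<_; _∸_; _⊓_; z≤n; s≤s; _<?_)
open import Data.Nat.Divisibility using (_∣0; ∣-refl; ∣1⇒≡1; ∣m+n∣m⇒∣n; ∣m∣n⇒∣m+n)
  renaming (_∣_ to _∣ℕ_)
import Data.Nat.Properties as ℕₚ
open import Data.Nat.Properties
  using ( +-cancelˡ-≡; +-mono-<; m∸n+n≡m; m+[n∸m]≡n; m≤n+m
        ; ≤-total; ≤-trans; <-≤-trans; ≤-<-trans; <⇒≤; <⇒≱; ≮⇒≥; <-irrefl; n≤1+n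
        ; m≤n⇒m<n∨m≡n; ⊓-glb; m<n⊓o⇒m<n; m<n⊓o⇒m<o)
open import Data.Sum using (inj₁; inj₂)
open import Function using (_∘_)
open import Relation.Binary.PropositionalEquality as ≡ using (_≡_; module ≡-Reasoning)
import Relation.Binary.Reasoning.Setoid as ≈-Reasoning

midpoint-offset : ∀ {p q c} → p ≤ q → p ℕ.+ q ≡ c ℕ.+ c → ∃[ k ] k ℕ.+ p ≡ c × k ℕ.+ c ≡ q
midpoint-offset {p} {q} {c} p≤q p+q≡c+c = c ∸ p , m∸n+n≡m p≤c , +-cancelˡ-≡ p _ _ p+[k+c]≡p+q
  where
  open ≡-Reasoning
  p≤c : p ≤ c
  p≤c = ≮⇒≥ λ c<p → <-irrefl (≡.sym p+q≡c+c) (+-mono-< c<p (<-≤-trans c<p p≤q))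
  p+[k+c]≡p+q : p ℕ.+ (c ∸ p ℕ.+ c) ≡ p ℕ.+ q
  p+[k+c]≡p+q = begin
    p ℕ.+ (c ∸ p ℕ.+ c)   ≡⟨ ℕₚ.+-assoc p (c ∸ p) c ⟨
    p ℕ.+ (c ∸ p) ℕ.+ c   ≡⟨ ≡.cong (ℕ._+ c) (m+[n∸m]≡n p≤c) ⟩
    c ℕ.+ c               ≡⟨ p+q≡c+c ⟨
    p ℕ.+ q               ∎

module AlternatingInverse {a ℓ} (G : AbelianGroup a ℓ) where
  open AbelianGroup G
  open GroupProperties group using (ε⁻¹≈ε; ⁻¹-involutive)
  open AbelianGroupProperties G using (⁻¹-∙-comm)

  infixl 8 _⁻¹^_
  _⁻¹^_ : Carrier → ℕ → Carrier
  x ⁻¹^ zero  = x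
  x ⁻¹^ suc d = (x ⁻¹^ d) ⁻¹

  ⁻¹^-cong : ∀ d {x y} → x ≈ y → x ⁻¹^ d ≈ y ⁻¹^ d
  ⁻¹^-cong zero    x≈y = x≈y
  ⁻¹^-cong (suc d) x≈y = ⁻¹-cong (⁻¹^-cong d x≈y)

  ε⁻¹^≈ε : ∀ d → ε ⁻¹^ d ≈ ε
  ε⁻¹^≈ε zero    = refl
  ε⁻¹^≈ε (suc d) = trans (⁻¹-cong (ε⁻¹^≈ε d)) ε⁻¹≈ε

  ⁻¹^-homo-∙ : ∀ d x y → (x ∙ y) ⁻¹^ d ≈ x ⁻¹^ d ∙ y ⁻¹^ d
  ⁻¹^-homo-∙ zero    x y = refl
  ⁻¹^-homo-∙ (suc d) x y = trans (⁻¹-cong (⁻¹^-homo-∙ d x y)) (sym (⁻¹-∙-comm _ _))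

  ⁻¹^-transpose : ∀ i j {x y} → x ⁻¹^ i ≈ y ⁻¹^ j → x ≈ y ⁻¹^ (i ℕ.+ j)
  ⁻¹^-transpose zero    j eq = eq
  ⁻¹^-transpose (suc i) j {x} {y} eq =
    trans (⁻¹^-transpose i (suc j) (trans (sym (⁻¹-involutive _)) (⁻¹-cong eq)))
          (reflexive (≡.cong (y ⁻¹^_) (ℕₚ.+-suc i j)))

  ⁻¹^-even : ∀ d {x} → 2 ∣ℕ d → x ⁻¹^ d ≈ x
  ⁻¹^-even zero          _     = refl
  ⁻¹^-even (suc zero)    2∣1   with () ← ∣1⇒≡1 2∣1
  ⁻¹^-even (suc (suc d)) 2∣2+d = trans (⁻¹-involutive _) (⁻¹^-even d (∣m+n∣m⇒∣n 2∣2+d ∣-refl))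

  ⁻¹^-odd : ∀ d {x} → ¬ 2 ∣ℕ d → x ⁻¹^ d ≈ x ⁻¹
  ⁻¹^-odd zero          2∤0   = ⊥-elim (2∤0 (2 ∣0))
  ⁻¹^-odd (suc zero)    _     = refl
  ⁻¹^-odd (suc (suc d)) 2∤2+d = trans (⁻¹-involutive _) (⁻¹^-odd d (2∤2+d ∘ ∣m∣n⇒∣m+n ∣-refl))

module Rectangle {c ℓ : Level} (K : Field c ℓ) {m n : ℕ}
                 (v : Fin m → Fin n → Field.Carrier K) (kernel : InKernel K m n v) where
  open Field K
  open GroupProperties +-group
    using (⁻¹-involutive; ⁻¹-injective; inverseˡ-unique; inverseʳ-unique; ∙-cancelˡ)
  open AbelianGroupProperties +-abelianGroup using (⁻¹-∙-comm)
  open AlternatingInverse +-abelianGroup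
  open ≈-Reasoning setoid

  inG : ∀ {a b} → a < m → b < n → InG m n (+ a) (+ b)
  inG a<m b<n = (ℤ.+≤+ z≤n , ℤ.+<+ a<m) , (ℤ.+≤+ z≤n , ℤ.+<+ b<n)

  ext-vanishes-from-G : ∀ {a b} → (a < m → b < n → ext K v (+ a) (+ b) ≈ 0#) → ext K v (+ a) (+ b) ≈ 0#
  ext-vanishes-from-G {a} {b} on-G with a <? m | b <? n
  ... | yes a<m | yes b<n = on-G a<m b<n
  ... | yes _   | no _    = refl
  ... | no _    | _       = refl

  -- Shifting both coordinates by one turns the zero extension into a border of zeros:
  -- grid (1 + a) (1 + b) = v_{a,b}, and grid vanishes on row 0 and column 0.
  grid : ℕ → ℕ → Carrier
  grid x y = ext K v (+ x ℤ.- + 1) (+ y ℤ.- + 1)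

  grid-row₀ : ∀ x → grid x 0 ≡ 0#
  grid-row₀ zero    = ≡.refl
  grid-row₀ (suc x) = ≡.refl

  grid-beyond : ∀ x {b} → n ≤ b → grid x (suc b) ≈ 0#
  grid-beyond zero    _   = refl
  grid-beyond (suc x) n≤b = ext-vanishes-from-G λ _ b<n → ⊥-elim (<⇒≱ b<n n≤b)

  grid-kernel : ∀ {a b} → a < m → b < n →
    grid (suc a) b + grid (suc a) (2 ℕ.+ b) + grid a (suc b) + grid (2 ℕ.+ a) (suc b) ≈ 0#
  grid-kernel {a} {b} a<m b<n =
    ≡.subst₂ (λ b′ a′ → grid (suc a) b + ext K v (+ a) (+ b′) + grid a (suc b) + ext K v (+ a′) (+ b) ≈ 0#)
             (ℕₚ.+-comm b 1) (ℕₚ.+-comm a 1) (kernel (+ a) (+ b) (inG a<m b<n))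

  signed : ℕ → ℕ → Carrier
  signed x y = grid x y ⁻¹^ x

  signed-row₀ : ∀ x → signed x 0 ≈ 0#
  signed-row₀ x = trans (⁻¹^-cong x (reflexive (grid-row₀ x))) (ε⁻¹^≈ε x)

  signed-balanced : ∀ {a b} → a < m → b < n →
    signed (suc a) b + signed (suc a) (2 ℕ.+ b) ≈ signed a (suc b) + signed (2 ℕ.+ a) (suc b)
  signed-balanced {a} {b} a<m b<n = begin
    - A₁ + - A₂       ≈⟨ ⁻¹-∙-comm A₁ A₂ ⟩
    - (A₁ + A₂)       ≈⟨ inverseʳ-unique (A₁ + A₂) (A₃ + A₄) A-sum≈0 ⟨
    A₃ + A₄           ≈⟨ +-congˡ (⁻¹-involutive A₄) ⟨
    A₃ + - - A₄       ∎
    where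
    G₁ G₂ G₃ G₄ A₁ A₂ A₃ A₄ : Carrier
    G₁ = grid (suc a) b
    G₂ = grid (suc a) (2 ℕ.+ b)
    G₃ = grid a (suc b)
    G₄ = grid (2 ℕ.+ a) (suc b)
    A₁ = G₁ ⁻¹^ a
    A₂ = G₂ ⁻¹^ a
    A₃ = G₃ ⁻¹^ a
    A₄ = G₄ ⁻¹^ a
    A-sum≈0 : A₁ + A₂ + (A₃ + A₄) ≈ 0#
    A-sum≈0 = begin
      A₁ + A₂ + (A₃ + A₄)        ≈⟨ +-assoc (A₁ + A₂) A₃ A₄ ⟨
      A₁ + A₂ + A₃ + A₄          ≈⟨ +-congʳ (+-congʳ (⁻¹^-homo-∙ a G₁ G₂)) ⟨
      (G₁ + G₂) ⁻¹^ a + A₃ + A₄  ≈⟨ +-congʳ (⁻¹^-homo-∙ a (G₁ + G₂) G₃) ⟨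
      (G₁ + G₂ + G₃) ⁻¹^ a + A₄  ≈⟨ ⁻¹^-homo-∙ a (G₁ + G₂ + G₃) G₄ ⟨
      (G₁ + G₂ + G₃ + G₄) ⁻¹^ a  ≈⟨ ⁻¹^-cong a (grid-kernel a<m b<n) ⟩
      0# ⁻¹^ a                   ≈⟨ ε⁻¹^≈ε a ⟩
      0#                         ∎

  signed-border : ∀ y → signed 0 y ≈ signed y 0
  signed-border y = sym (signed-row₀ y)

  signed-symmetric-adjacent : ∀ {b} → b < m ⊓ n →
    signed b (suc b) ≈ signed (suc b) b →
    signed (suc b) (2 ℕ.+ b) ≈ signed (2 ℕ.+ b) (suc b)
  signed-symmetric-adjacent {b} b<s sym-b = ∙-cancelˡ (signed (suc b) b) _ _ (begin
    signed (suc b) b + signed (suc b) (2 ℕ.+ b)  ≈⟨ signed-balanced (m<n⊓o⇒m<n m n b<s) (m<n⊓o⇒m<o m n b<s) ⟩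
    signed b (suc b) + signed (2 ℕ.+ b) (suc b)  ≈⟨ +-congʳ sym-b ⟩
    signed (suc b) b + signed (2 ℕ.+ b) (suc b)  ∎)

  signed-symmetric-far : ∀ {a b} → a < m ⊓ n → b < m ⊓ n →
    signed (suc a) b ≈ signed b (suc a) →
    signed a (suc b) ≈ signed (suc b) a →
    signed (2 ℕ.+ a) (suc b) ≈ signed (suc b) (2 ℕ.+ a) →
    signed (suc a) (2 ℕ.+ b) ≈ signed (2 ℕ.+ b) (suc a)
  signed-symmetric-far {a} {b} a<s b<s sym₁ sym₂ sym₃ = ∙-cancelˡ (signed b (suc a)) _ _ (begin
    signed b (suc a) + signed (suc a) (2 ℕ.+ b)  ≈⟨ +-congʳ sym₁ ⟨
    signed (suc a) b + signed (suc a) (2 ℕ.+ b)  ≈⟨ signed-balanced (m<n⊓o⇒m<n m n a<s) (m<n⊓o⇒m<o m n b<s) ⟩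
    signed a (suc b) + signed (2 ℕ.+ a) (suc b)  ≈⟨ +-cong sym₂ sym₃ ⟩
    signed (suc b) a + signed (suc b) (2 ℕ.+ a)  ≈⟨ signed-balanced (m<n⊓o⇒m<n m n b<s) (m<n⊓o⇒m<o m n a<s) ⟩
    signed b (suc a) + signed (2 ℕ.+ b) (suc a)  ∎)

  SymmetricAt : ℕ → Set ℓ
  SymmetricAt y = ∀ {x} → x ≤ y → signed x y ≈ signed y x

  symmetric-step : ∀ {b} → 2 ℕ.+ b ≤ m ⊓ n → SymmetricAt b → SymmetricAt (suc b) → SymmetricAt (2 ℕ.+ b)
  symmetric-step {b} _   _    _      {zero}  _ = signed-border (2 ℕ.+ b)
  symmetric-step {b} y≤s at-b at-1+b {suc x} (s≤s x≤1+b) with m≤n⇒m<n∨m≡n x≤1+b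
  ... | inj₂ ≡.refl = refl
  ... | inj₁ (s≤s x≤b) with m≤n⇒m<n∨m≡n x≤b
  ...   | inj₂ ≡.refl = signed-symmetric-adjacent b<s (at-1+b (n≤1+n b))
    where
    b<s : b < m ⊓ n
    b<s = <⇒≤ y≤s
  ...   | inj₁ x<b = signed-symmetric-far (≤-<-trans x≤b b<s) b<s
                       (at-b x<b) (at-1+b (≤-trans x≤b (n≤1+n b))) (at-1+b (s≤s x<b))
    where
    b<s : b < m ⊓ n
    b<s = <⇒≤ y≤s

  symmetric-at-pair : ∀ y → suc y ≤ m ⊓ n → SymmetricAt y × SymmetricAt (suc y)
  symmetric-at-pair zero    _   = (λ { z≤n → refl }) , λ { z≤n → signed-border 1 ; (s≤s z≤n) → refl }
  symmetric-at-pair (suc y) y≤s = at-1+y , symmetric-step y≤s at-y at-1+y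
    where
    at-y : SymmetricAt y
    at-y = proj₁ (symmetric-at-pair y (<⇒≤ y≤s))
    at-1+y : SymmetricAt (suc y)
    at-1+y = proj₂ (symmetric-at-pair y (<⇒≤ y≤s))

  symmetric-at : ∀ {y} → y ≤ m ⊓ n → SymmetricAt y
  symmetric-at {zero}  _   z≤n = refl
  symmetric-at {suc y} y≤s     = proj₂ (symmetric-at-pair y y≤s)

  signed-symmetric : ∀ {x y} → x ≤ m ⊓ n → y ≤ m ⊓ n → signed x y ≈ signed y x
  signed-symmetric {x} {y} x≤s y≤s with ≤-total x y
  ... | inj₁ x≤y = symmetric-at y≤s x≤y
  ... | inj₂ y≤x = sym (symmetric-at x≤s y≤x)

  ext-transpose : ∀ {a b} → a < m → a < n → b < m → b < n →
    ext K v (+ a) (+ b) ≈ ext K v (+ b) (+ a) ⁻¹^ (a ℕ.+ b)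
  ext-transpose {a} {b} a<m a<n b<m b<n =
    ⁻¹^-transpose a b (⁻¹-injective (signed-symmetric (⊓-glb a<m a<n) (⊓-glb b<m b<n)))

  ext-transpose-parity : ∀ (i j : ℤ) → InG m n i j → InG m n j i →
    ((+ 2 ∣ (i ℤ.+ j)) → ext K v i j ≈ ext K v j i) ×
    (¬ (+ 2 ∣ (i ℤ.+ j)) → ext K v i j ≈ - ext K v j i)
  ext-transpose-parity ℤ.-[1+ _ ] _         ((() , _) , _) _
  ext-transpose-parity (+ _)      ℤ.-[1+ _ ] (_ , (() , _)) _
  ext-transpose-parity (+ a) (+ b) ((_ , ℤ.+<+ a<m) , (_ , ℤ.+<+ b<n)) ((_ , ℤ.+<+ b<m) , (_ , ℤ.+<+ a<n)) =
    (λ 2∣a+b → trans transposed (⁻¹^-even (a ℕ.+ b) 2∣a+b)) ,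
    (λ 2∤a+b → trans transposed (⁻¹^-odd (a ℕ.+ b) 2∤a+b))
    where
    transposed : ext K v (+ a) (+ b) ≈ ext K v (+ b) (+ a) ⁻¹^ (a ℕ.+ b)
    transposed = ext-transpose a<m a<n b<m b<n

  VanishingColumn : ℕ → Set ℓ
  VanishingColumn c = ∀ y → grid c y ≈ 0#

  OppositeColumns : ℕ → ℕ → Set ℓ
  OppositeColumns l r = ∀ y → grid l y + grid r y ≈ 0#

  opposite-sym : ∀ {l r} → OppositeColumns l r → OppositeColumns r l
  opposite-sym opposite y = trans (+-comm _ _) (opposite y)

  opposite-by-rows : ∀ {l r} → (∀ {b} → b < n → grid l (suc b) + grid r (suc b) ≈ 0#) → OppositeColumns l r
  opposite-by-rows {l} {r} rows zero =
    trans (+-cong (reflexive (grid-row₀ l)) (reflexive (grid-row₀ r))) (+-identityˡ 0#)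
  opposite-by-rows {l} {r} rows (suc b) with b <? n
  ... | yes b<n = rows b<n
  ... | no b≮n  = trans (+-cong (grid-beyond l (≮⇒≥ b≮n)) (grid-beyond r (≮⇒≥ b≮n))) (+-identityˡ 0#)

  opposite-beside-vanishing : ∀ {c} → c < m → VanishingColumn (suc c) → OppositeColumns c (2 ℕ.+ c)
  opposite-beside-vanishing {c} c<m vanishes = opposite-by-rows {c} {2 ℕ.+ c} λ {b} b<n → begin
    grid c (suc b) + grid (2 ℕ.+ c) (suc b)                 ≈⟨ +-congʳ (+-identityˡ _) ⟨
    0# + grid c (suc b) + grid (2 ℕ.+ c) (suc b)            ≈⟨ +-congʳ (+-congʳ (+-identityˡ 0#)) ⟨
    0# + 0# + grid c (suc b) + grid (2 ℕ.+ c) (suc b)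
      ≈⟨ +-congʳ (+-congʳ (+-cong (vanishes b) (vanishes (2 ℕ.+ b)))) ⟨
    grid (suc c) b + grid (suc c) (2 ℕ.+ b) + grid c (suc b) + grid (2 ℕ.+ c) (suc b)
      ≈⟨ grid-kernel c<m b<n ⟩
    0#                                                      ∎

  opposite-step : ∀ {l r} → l < m → r < m →
    OppositeColumns (2 ℕ.+ l) r → OppositeColumns (suc l) (suc r) → OppositeColumns l (2 ℕ.+ r)
  opposite-step {l} {r} l<m r<m inner middle = opposite-by-rows {l} {2 ℕ.+ r} λ {b} b<n → begin
    grid l (suc b) + grid (2 ℕ.+ r) (suc b)                       ≈⟨ +-identityʳ _ ⟨
    grid l (suc b) + grid (2 ℕ.+ r) (suc b) + 0#                  ≈⟨ +-congˡ (pairs≈0 b) ⟨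
    grid l (suc b) + grid (2 ℕ.+ r) (suc b) + pairs b             ≈⟨ regroup _ _ _ _ _ _ _ _ ⟨
    kernel-sum l b + kernel-sum r b                               ≈⟨ +-cong (grid-kernel l<m b<n) (grid-kernel r<m b<n) ⟩
    0# + 0#                                                       ≈⟨ +-identityˡ 0# ⟩
    0#                                                            ∎
    where
    open CommutativeMonoidSolver +-commutativeMonoid using (solve; _⊜_; _⊕_)
    kernel-sum : ℕ → ℕ → Carrier
    kernel-sum x b = grid (suc x) b + grid (suc x) (2 ℕ.+ b) + grid x (suc b) + grid (2 ℕ.+ x) (suc b)
    pairs : ℕ → Carrier
    pairs b = (grid (suc l) b + grid (suc r) b) + (grid (suc l) (2 ℕ.+ b) + grid (suc r) (2 ℕ.+ b))
              + (grid (2 ℕ.+ l) (suc b) + grid r (suc b))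
    pairs≈0 : ∀ b → pairs b ≈ 0#
    pairs≈0 b = trans (+-cong (+-cong (middle b) (middle (2 ℕ.+ b))) (inner (suc b)))
                      (trans (+-congʳ (+-identityˡ 0#)) (+-identityˡ 0#))
    regroup : ∀ a b c d a′ b′ c′ d′ →
      (a + b + c + d) + (a′ + b′ + c′ + d′) ≈ (c + d′) + ((a + a′) + (b + b′) + (d + c′))
    regroup = solve 8 (λ a b c d a′ b′ c′ d′ →
      (((a ⊕ b) ⊕ c) ⊕ d) ⊕ (((a′ ⊕ b′) ⊕ c′) ⊕ d′)
        ⊜ (c ⊕ d′) ⊕ (((a ⊕ a′) ⊕ (b ⊕ b′)) ⊕ (d ⊕ c′))) refl

  opposite-around : ∀ k {l c r} → VanishingColumn (suc c) → k ℕ.+ l ≡ c → k ℕ.+ c ≡ r → r < m →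
    OppositeColumns (suc l) (suc r)
  opposite-around zero                  vanishes ≡.refl ≡.refl _   y =
    trans (+-cong (vanishes y) (vanishes y)) (+-identityˡ 0#)
  opposite-around (suc zero)            vanishes ≡.refl ≡.refl r<m =
    opposite-beside-vanishing (<⇒≤ r<m) vanishes
  opposite-around (suc (suc k)) {l} {c} vanishes ≡.refl ≡.refl r<m =
    opposite-step (≤-<-trans (s≤s l≤r′) 1+r′<m) 1+r′<m
      (opposite-around k vanishes k+[2+l]≡c ≡.refl (<⇒≤ 1+r′<m))
      (opposite-around (suc k) vanishes (≡.cong suc (ℕₚ.+-suc k l)) ≡.refl 1+r′<m)
    where
    1+r′<m : suc (k ℕ.+ c) < m
    1+r′<m = <⇒≤ r<m
    l≤r′ : l ≤ k ℕ.+ c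
    l≤r′ = ≤-trans (m≤n+m l (2 ℕ.+ k)) (m≤n+m c k)
    k+[2+l]≡c : k ℕ.+ (2 ℕ.+ l) ≡ c
    k+[2+l]≡c = ≡.trans (ℕₚ.+-suc k (suc l)) (≡.cong suc (ℕₚ.+-suc k l))

  opposite-columns-≤ : ∀ {p q c} → VanishingColumn (suc c) → p ≤ q → p ℕ.+ q ≡ c ℕ.+ c → q < m →
    OppositeColumns (suc p) (suc q)
  opposite-columns-≤ vanishes p≤q p+q≡c+c q<m with midpoint-offset p≤q p+q≡c+c
  ... | k , k+p≡c , k+c≡q = opposite-around k vanishes k+p≡c k+c≡q q<m

  opposite-columns : ∀ {p q c} → VanishingColumn (suc c) → p ℕ.+ q ≡ c ℕ.+ c → p < m → q < m →
    OppositeColumns (suc p) (suc q)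
  opposite-columns {p} {q} vanishes p+q≡c+c p<m q<m with ≤-total p q
  ... | inj₁ p≤q = opposite-columns-≤ vanishes p≤q p+q≡c+c q<m
  ... | inj₂ q≤p = opposite-sym {suc q} {suc p}
                     (opposite-columns-≤ vanishes q≤p (≡.trans (ℕₚ.+-comm q p) p+q≡c+c) p<m)

  column-vanishes : ∀ {c} → (∀ j → InG m n (+ c) j → ext K v (+ c) j ≈ 0#) → VanishingColumn (suc c)
  column-vanishes vanishes zero    = refl
  column-vanishes vanishes (suc b) = ext-vanishes-from-G λ c<m b<n → vanishes (+ b) (inG c<m b<n)

  ext-antisymmetric-about : ∀ (p q c j : ℤ) → p ℤ.+ q ≡ c ℤ.+ c →
    (∀ j → InG m n c j → ext K v c j ≈ 0#) →
    InG m n p j → InG m n q j → ext K v p j ≈ - ext K v q j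
  ext-antisymmetric-about ℤ.-[1+ _ ] _          _          _          _          _ ((() , _) , _) _
  ext-antisymmetric-about (+ _)      ℤ.-[1+ _ ] _          _          _          _ _              ((() , _) , _)
  ext-antisymmetric-about (+ _)      (+ _)      _          ℤ.-[1+ _ ] _          _ (_ , (() , _)) _
  ext-antisymmetric-about (+ _)      (+ _)      ℤ.-[1+ _ ] (+ _)      ()
  ext-antisymmetric-about (+ p) (+ q) (+ c) (+ b) p+q≡c+c vanishes ((_ , ℤ.+<+ p<m) , _) ((_ , ℤ.+<+ q<m) , _) =
    inverseˡ-unique _ _ (opposite-columns (column-vanishes vanishes) (ℤₚ.+-injective p+q≡c+c) p<m q<m (suc b))

midpoint-sum : ∀ c i → (c ℤ.- i) ℤ.+ (c ℤ.+ i) ≡ c ℤ.+ c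
midpoint-sum = solve-∀

proposition1 : ∀ {c ℓ : Level} (K : Field c ℓ) (m n : ℕ) → 1 ℕ.≤ m → 1 ℕ.≤ n →
    (v : Fin m → Fin n → Field.Carrier K) → InKernel K m n v →
    -- (i)
    (∀ (i j : ℤ) → InG m n i j → InG m n j i →
      ((+ 2 ∣ (i ℤ.+ j)) → Field._≈_ K (ext K v i j) (ext K v j i)) ×
      (¬ (+ 2 ∣ (i ℤ.+ j)) → Field._≈_ K (ext K v i j) (Field.-_ K (ext K v j i))))
    ×
    -- (ii)
    (∀ (m₀ : ℤ) → (∀ (j : ℤ) → InG m n m₀ j → Field._≈_ K (ext K v m₀ j) (Field.0# K)) →
      ∀ (i j : ℤ) → InG m n (m₀ ℤ.- i) j → InG m n (m₀ ℤ.+ i) j →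
        Field._≈_ K (ext K v (m₀ ℤ.- i) j) (Field.-_ K (ext K v (m₀ ℤ.+ i) j)))
proposition1 K m n _ _ v kernel =
  ext-transpose-parity ,
  λ m₀ vanishes i j → ext-antisymmetric-about (m₀ ℤ.- i) (m₀ ℤ.+ i) m₀ j (midpoint-sum m₀ i) vanishes
  where open Rectangle K v kernel
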